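{- In the polynomial algebra $\mathbb{C}[a_u: u\in\mathbb{F}_2^r\setminus\{\mathbf 0\}]$ one has the equality of $\mathbb{Z}$-spans \[\operatorname{span}_{\mathbb{Z}}\Big\{\sum_{u\cdot v=1}a_u\ \Big|\ v\in\mathbb{F}_2^r\Big\}=\operatorname{span}_{\mathbb{Z}}\Big\{2^{|S|-1}\sum_{u_S=d}a_u\ \Big|\ \emptyset\neq S\subseteq[r],\ d\in\mathbb{F}_2^{|S|}\setminus\{\mathbf 0\}\Big\}.\]
   Context: $[r]=\{1,\dots,r\}$. Sums range over $u\in\mathbb{F}_2^r\setminus\{\mathbf 0\}$. For $S\subseteq[r]$ and $d\in\mathbb{F}_2^{|S|}$, the condition $u_S=d$ means that the coordinates $u_i$, $i\in S$ (in increasing order of $i$), agree with the entries of $d$. -}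

module Defs where

open import Data.Nat using (ℕ; zero; suc; _^_; _∸_)
open import Data.Integer using (ℤ; +_; _+_; _*_)
open import Data.Bool using (Bool; true; false; _∧_; _xor_; if_then_else_)
open import Data.Vec using (Vec; []; _∷_; zipWith; foldr; replicate; toList)
open import Data.List using (List; []; _∷_)
import Data.List.Properties as LP
import Data.Bool.Properties as BP
open import Data.Product using (Σ; _×_; _,_; ∃)
open import Data.Fin.Subset using (Subset; Side; inside; outside; ∣_∣; Nonempty)
open import Relation.Binary.PropositionalEquality using (_≡_; _≢_)
open import Relation.Nullary using (yes; no)

-- F₂^r as Bool-vectors (true = 1, false = 0).
F2 : ℕ → Set
F2 r = Vec Bool r

_·_ : ∀ {r} → F2 r → F2 r → Bool
u · v = foldr _ _xor_ false (zipWith _∧_ u v)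

restrict : ∀ {r} → F2 r → Subset r → List Bool
restrict [] [] = []
restrict (x ∷ u) (inside ∷ S) = x ∷ restrict u S
restrict (x ∷ u) (outside ∷ S) = restrict u S

-- A linear form Σ_u c_u a_u with integer coefficients in the variables a_u,
-- represented by its coefficient function u ↦ c_u.
LinForm : ℕ → Set
LinForm r = F2 r → ℤ

lincomb : ∀ {r} {I : Set} → (I → LinForm r) → List (ℤ × I) → LinForm r
lincomb g [] u = + 0
lincomb g ((c , i) ∷ cs) u = c * g i u + lincomb g cs u

InSpan : ∀ {r} {I : Set} → (I → LinForm r) → LinForm r → Set
InSpan {r} {I} g f = Σ (List (ℤ × I)) λ cs → ∀ u → f u ≡ lincomb g cs u

SpanEq : ∀ {r} {I J : Set} → (I → LinForm r) → (J → LinForm r) → Set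
SpanEq g h = (∀ i → InSpan h (g i)) × (∀ j → InSpan g (h j))

leftGen : ∀ {r} → F2 r → LinForm r
leftGen v u = if u · v then + 1 else + 0

RightIdx : ℕ → Set
RightIdx r = Σ (Subset r) λ S → Nonempty S × Σ (Vec Bool ∣ S ∣) λ d → d ≢ replicate _ false

rightGen : ∀ {r} → RightIdx r → LinForm r
rightGen (S , _ , d , _) u with LP.≡-dec BP._≟_ (restrict u S) (toList d)
... | yes _ = + (2 ^ (∣ S ∣ ∸ 1))
... | no _ = + 0

-- Write χ_w(u) = (-1)^(u·w) = 1 - 2 [u·w = 1]. Since [u₁ + u·v = 1] = [u₁] + [u·v] - 2 [u₁] [u·v],
-- induction on the coordinates of v writes each Σ_{u·v=1} a_u as a signed sum of right generators
-- (with d = (1,…,1)). Conversely 2^|S| [u_S = d] = ∏_{i∈S} (1 + (-1)^(u_i + d_i)) is an integer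
-- combination Σ_w c_w χ_w. Substituting χ_w = 1 - 2 [u·w = 1] and evaluating at u = 0, where the
-- left side vanishes because d ≠ 0, gives Σ_w c_w = 0, hence 2^(|S|-1) [u_S = d] = -Σ_w c_w [u·w = 1].

module Submission where

open import Defs
open import Data.Nat as ℕ using (ℕ; zero; suc; _^_; _∸_)
open import Data.Integer using (ℤ; +_; _+_; _-_; _*_; -_)
open import Data.Integer.Properties
  using (+-identityˡ; +-identityʳ; +-assoc; *-assoc; *-identityˡ; *-identityʳ; *-zeroʳ; *-cancelˡ-≡; pos-*)
open import Data.Integer.Tactic.RingSolver using (solve-∀)
open import Data.Bool using (Bool; true; false; _∧_; if_then_else_)
open import Data.Bool.Properties using (_≟_)
open import Data.Vec using (Vec; []; _∷_; replicate; toList; head; tail; here; there)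
open import Data.Vec.Properties using (toList-injective; cast-is-id)
open import Data.List using (List; []; _∷_; _++_)
open import Data.List.Properties using (≡-dec)
open import Data.Product using (_×_; _,_)
import Data.Fin as Fin
open import Data.Fin.Subset using (Subset; inside; outside; ∣_∣; ⊥)
open import Data.Fin.Subset.Properties using (∣⊥∣≡0)
open import Relation.Binary.PropositionalEquality
open import Relation.Nullary using (yes; no; does; contradiction)

scale : ∀ {I : Set} → ℤ → List (ℤ × I) → List (ℤ × I)
scale k [] = []
scale k ((c , i) ∷ cs) = (k * c , i) ∷ scale k cs

module _ {r} {I : Set} {g : I → LinForm r} where

  lincomb-++ : ∀ cs ds u → lincomb g (cs ++ ds) u ≡ lincomb g cs u + lincomb g ds u
  lincomb-++ [] ds u = sym (+-identityˡ _)
  lincomb-++ ((c , i) ∷ cs) ds u rewrite lincomb-++ cs ds u = sym (+-assoc (c * g i u) _ _)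

  lincomb-scale : ∀ k cs u → lincomb g (scale k cs) u ≡ k * lincomb g cs u
  lincomb-scale k [] u = sym (*-zeroʳ k)
  lincomb-scale k ((c , i) ∷ cs) u rewrite lincomb-scale k cs u = distrib k c (g i u) _
    where
    distrib : ∀ k c x y → k * c * x + k * y ≡ k * (c * x + y)
    distrib = solve-∀

  InSpan-resp : ∀ {f f′} → f ≗ f′ → InSpan g f → InSpan g f′
  InSpan-resp f≗f′ (cs , f≗) = cs , λ u → trans (sym (f≗f′ u)) (f≗ u)

  InSpan-gen : ∀ i → InSpan g (g i)
  InSpan-gen i = (+ 1 , i) ∷ [] , λ u → sym (trans (+-identityʳ _) (*-identityˡ _))

  InSpan-+ : ∀ {f f′} → InSpan g f → InSpan g f′ → InSpan g (λ u → f u + f′ u)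
  InSpan-+ (cs , f≗) (ds , f′≗) =
    cs ++ ds , λ u → trans (cong₂ _+_ (f≗ u) (f′≗ u)) (sym (lincomb-++ cs ds u))

  InSpan-* : ∀ k {f} → InSpan g f → InSpan g (λ u → k * f u)
  InSpan-* k (cs , f≗) = scale k cs , λ u → trans (cong (k *_) (f≗ u)) (sym (lincomb-scale k cs u))

InSpan-pullback : ∀ {r s} {I J : Set} {g : I → LinForm r} {h : J → LinForm s}
  (w : F2 s → ℤ) (τ : F2 s → F2 r) →
  (∀ i → InSpan h (λ x → w x * g i (τ x))) →
  ∀ {f} → InSpan g f → InSpan h (λ x → w x * f (τ x))
InSpan-pullback {g = g} w τ gen (cs , f≗) =
  InSpan-resp (λ x → cong (w x *_) (sym (f≗ (τ x)))) (pullback cs)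
  where
  distrib : ∀ w c x y → c * (w * x) + w * y ≡ w * (c * x + y)
  distrib = solve-∀

  pullback : ∀ cs → InSpan _ (λ x → w x * lincomb g cs (τ x))
  pullback [] = [] , λ x → *-zeroʳ (w x)
  pullback ((c , i) ∷ cs) =
    InSpan-resp (λ x → distrib (w x) c (g i (τ x)) _) (InSpan-+ (InSpan-* c (gen i)) (pullback cs))

toℤ : Bool → ℤ
toℤ b = if b then + 1 else + 0

-1^_ : Bool → ℤ
-1^ b = if b then - + 1 else + 1

toℤ-∧ : ∀ a b → toℤ (a ∧ b) ≡ toℤ a * toℤ b
toℤ-∧ true b = sym (*-identityˡ _)
toℤ-∧ false b = refl

toℤ-≟-true : ∀ a → toℤ (does (a ≟ true)) ≡ toℤ a
toℤ-≟-true true = refl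
toℤ-≟-true false = refl

-- A nonzero vector has positive length, so the truncated n ∸ 1 is a genuine predecessor.
2^n≡2*2^[n∸1] : ∀ {n} (d : Vec Bool n) → d ≢ replicate n false → 2 ^ n ≡ 2 ℕ.* 2 ^ (n ∸ 1)
2^n≡2*2^[n∸1] [] d≢0 = contradiction refl d≢0
2^n≡2*2^[n∸1] (_ ∷ _) _ = refl

restrict-replicate : ∀ {r} x (S : Subset r) → restrict (replicate r x) S ≡ toList (replicate ∣ S ∣ x)
restrict-replicate x [] = refl
restrict-replicate x (inside ∷ S) = cong (x ∷_) (restrict-replicate x S)
restrict-replicate x (outside ∷ S) = restrict-replicate x S

replicate-false-· : ∀ {r} (w : F2 r) → replicate r false · w ≡ false
replicate-false-· [] = refl
replicate-false-· (_ ∷ w) = replicate-false-· w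

cylinder : ∀ {r} (S : Subset r) → Vec Bool ∣ S ∣ → LinForm r
cylinder S d u = toℤ (does (≡-dec _≟_ (restrict u S) (toList d)))

cylinder-inside : ∀ {r} {S : Subset r} a b d u →
  cylinder (inside ∷ S) (b ∷ d) (a ∷ u) ≡ toℤ (does (a ≟ b)) * cylinder S d u
cylinder-inside a b d u = toℤ-∧ (does (a ≟ b)) _

cylinder-⊥ : ∀ {r} (d : Vec Bool ∣ ⊥ {r} ∣) (u : F2 r) → cylinder ⊥ d u ≡ + 1
cylinder-⊥ {zero} [] [] = refl
cylinder-⊥ {suc r} d (_ ∷ u) = cylinder-⊥ {r} d u

cylinder-zero : ∀ {r} (S : Subset r) (d : Vec Bool ∣ S ∣) →
  d ≢ replicate _ false → cylinder S d (replicate r false) ≡ + 0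
cylinder-zero S d d≢0 with ≡-dec _≟_ (restrict (replicate _ false) S) (toList d)
... | yes eq = contradiction d≡0 d≢0
  where
  d≡0 : d ≡ replicate _ false
  d≡0 = trans (sym (cast-is-id refl d))
              (toList-injective refl d _ (trans (sym eq) (restrict-replicate false S)))
... | no _ = refl

rightGen-cylinder : ∀ {r} (j@(S , _ , d , _) : RightIdx r) u →
  rightGen j u ≡ + (2 ^ (∣ S ∣ ∸ 1)) * cylinder S d u
rightGen-cylinder (S , _ , d , _) u with ≡-dec _≟_ (restrict u S) (toList d)
... | yes _ = sym (*-identityʳ (+ (2 ^ (∣ S ∣ ∸ 1))))
... | no _ = sym (*-zeroʳ (+ (2 ^ (∣ S ∣ ∸ 1))))

rightGen-double : ∀ {r} (j@(S , _ , d , _) : RightIdx r) u →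
  + 2 * rightGen j u ≡ + (2 ^ ∣ S ∣) * cylinder S d u
rightGen-double j@(S , _ , d , d≢0) u = begin
  + 2 * rightGen j u                                ≡⟨ cong (+ 2 *_) (rightGen-cylinder j u) ⟩
  + 2 * (+ (2 ^ (∣ S ∣ ∸ 1)) * cylinder S d u)      ≡⟨ sym (*-assoc (+ 2) (+ (2 ^ (∣ S ∣ ∸ 1))) (cylinder S d u)) ⟩
  + 2 * + (2 ^ (∣ S ∣ ∸ 1)) * cylinder S d u        ≡⟨ cong (_* cylinder S d u) (sym (pos-* 2 (2 ^ (∣ S ∣ ∸ 1)))) ⟩
  + (2 ℕ.* 2 ^ (∣ S ∣ ∸ 1)) * cylinder S d u        ≡⟨ cong (λ m → + m * cylinder S d u) (sym (2^n≡2*2^[n∸1] d d≢0)) ⟩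
  + (2 ^ ∣ S ∣) * cylinder S d u                    ∎
  where open ≡-Reasoning

extendOutside : ∀ {r} → RightIdx r → RightIdx (suc r)
extendOutside (S , (i , i∈S) , d , d≢0) = outside ∷ S , (Fin.suc i , there i∈S) , d , d≢0

extendInside : ∀ {r} → RightIdx r → RightIdx (suc r)
extendInside (S , _ , d , _) = inside ∷ S , (Fin.zero , here) , true ∷ d , λ ()

firstCoordinate : ∀ {r} → RightIdx (suc r)
firstCoordinate = inside ∷ ⊥ , (Fin.zero , here) , true ∷ replicate _ false , λ ()

rightGen-extendOutside : ∀ {r} (j : RightIdx r) a u → rightGen (extendOutside j) (a ∷ u) ≡ rightGen j u
rightGen-extendOutside j@(_ , (_ , _) , _ , _) a u =
  trans (rightGen-cylinder (extendOutside j) (a ∷ u)) (sym (rightGen-cylinder j u))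

rightGen-extendInside : ∀ {r} (j : RightIdx r) a u →
  rightGen (extendInside j) (a ∷ u) ≡ + 2 * toℤ a * rightGen j u
rightGen-extendInside j@(S , _ , d , _) a u = begin
  rightGen (extendInside j) (a ∷ u)                          ≡⟨ rightGen-cylinder (extendInside j) (a ∷ u) ⟩
  + (2 ^ ∣ S ∣) * cylinder (inside ∷ S) (true ∷ d) (a ∷ u)   ≡⟨ cong (+ (2 ^ ∣ S ∣) *_) (cylinder-inside a true d u) ⟩
  + (2 ^ ∣ S ∣) * (toℤ (does (a ≟ true)) * cylinder S d u)   ≡⟨ cong (λ x → + (2 ^ ∣ S ∣) * (x * cylinder S d u)) (toℤ-≟-true a) ⟩
  + (2 ^ ∣ S ∣) * (toℤ a * cylinder S d u)                   ≡⟨ swap (+ (2 ^ ∣ S ∣)) (toℤ a) (cylinder S d u) ⟩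
  toℤ a * (+ (2 ^ ∣ S ∣) * cylinder S d u)                   ≡⟨ cong (toℤ a *_) (sym (rightGen-double j u)) ⟩
  toℤ a * (+ 2 * rightGen j u)                               ≡⟨ reorder (toℤ a) (+ 2) (rightGen j u) ⟩
  + 2 * toℤ a * rightGen j u                                 ∎
  where
  open ≡-Reasoning
  swap : ∀ x y z → x * (y * z) ≡ y * (x * z)
  swap = solve-∀
  reorder : ∀ x y z → x * (y * z) ≡ y * x * z
  reorder = solve-∀

rightGen-firstCoordinate : ∀ {r} a (u : F2 r) → rightGen firstCoordinate (a ∷ u) ≡ toℤ a
rightGen-firstCoordinate {r} a u = begin
  rightGen firstCoordinate (a ∷ u)                                        ≡⟨ rightGen-cylinder firstCoordinate (a ∷ u) ⟩
  + (2 ^ ∣ ⊥ {r} ∣) * cylinder (inside ∷ ⊥) (true ∷ replicate _ false) (a ∷ u)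
    ≡⟨ cong (+ (2 ^ ∣ ⊥ {r} ∣) *_) (cylinder-inside a true (replicate _ false) u) ⟩
  + (2 ^ ∣ ⊥ {r} ∣) * (toℤ (does (a ≟ true)) * cylinder ⊥ (replicate _ false) u)
    ≡⟨ cong₂ (λ n x → + (2 ^ n) * (x * cylinder ⊥ (replicate _ false) u)) (∣⊥∣≡0 r) (toℤ-≟-true a) ⟩
  + 1 * (toℤ a * cylinder ⊥ (replicate _ false) u)                        ≡⟨ *-identityˡ _ ⟩
  toℤ a * cylinder ⊥ (replicate _ false) u                                ≡⟨ cong (toℤ a *_) (cylinder-⊥ (replicate _ false) u) ⟩
  toℤ a * + 1                                                             ≡⟨ *-identityʳ (toℤ a) ⟩
  toℤ a                                                                   ∎
  where open ≡-Reasoning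

module _ {r} {f : LinForm r} where

  InSpan-extendOutside : InSpan rightGen f → InSpan rightGen (λ x → + 1 * f (tail x))
  InSpan-extendOutside = InSpan-pullback (λ _ → + 1) tail λ j →
    InSpan-resp (λ { (a ∷ u) → trans (rightGen-extendOutside j a u) (sym (*-identityˡ _)) })
                (InSpan-gen (extendOutside j))

  InSpan-extendInside : InSpan rightGen f → InSpan rightGen (λ x → + 2 * toℤ (head x) * f (tail x))
  InSpan-extendInside = InSpan-pullback (λ x → + 2 * toℤ (head x)) tail λ j →
    InSpan-resp (λ { (a ∷ u) → rightGen-extendInside j a u }) (InSpan-gen (extendInside j))

leftGen-true-∷ : ∀ {r} a (u v : F2 r) →
  rightGen firstCoordinate (a ∷ u) + (+ 1 * leftGen v u + - + 1 * (+ 2 * toℤ a * leftGen v u))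
  ≡ leftGen (true ∷ v) (a ∷ u)
leftGen-true-∷ a u v rewrite rightGen-firstCoordinate a u with a | u · v
... | true  | true  = refl
... | true  | false = refl
... | false | true  = refl
... | false | false = refl

leftGen∈span : ∀ {r} (v : F2 r) → InSpan rightGen (leftGen v)
leftGen∈span [] = [] , λ { [] → refl }
leftGen∈span (false ∷ v) =
  InSpan-resp (λ { (true ∷ u) → *-identityˡ _ ; (false ∷ u) → *-identityˡ _ })
              (InSpan-extendOutside (leftGen∈span v))
leftGen∈span (true ∷ v) =
  InSpan-resp (λ { (a ∷ u) → leftGen-true-∷ a u v })
              (InSpan-+ (InSpan-gen firstCoordinate)
                        (InSpan-+ (InSpan-extendOutside (leftGen∈span v))
                                  (InSpan-* (- + 1) (InSpan-extendInside (leftGen∈span v)))))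

character : ∀ {r} → F2 r → LinForm r
character w u = if u · w then - + 1 else + 1

character-leftGen : ∀ {r} (w u : F2 r) → character w u ≡ + 1 - + 2 * leftGen w u
character-leftGen w u with u · w
... | true = refl
... | false = refl

character-zero : ∀ {r} (w : F2 r) → character w (replicate r false) ≡ + 1
character-zero w rewrite replicate-false-· w = refl

lincomb-character : ∀ {r} cs (u : F2 r) →
  lincomb character cs u ≡ lincomb character cs (replicate r false) - + 2 * lincomb leftGen cs u
lincomb-character [] u = refl
lincomb-character ((c , w) ∷ cs) u
  rewrite lincomb-character cs u | character-leftGen w u | character-zero w =
  expand c (leftGen w u) (lincomb character cs _) (lincomb leftGen cs u)
  where
  expand : ∀ c x y z → c * (+ 1 - + 2 * x) + (y - + 2 * z) ≡ c * + 1 + y - + 2 * (c * x + z)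
  expand = solve-∀

-- 2 [a = b] = 1 + (-1)^(a + b)
parity-split : ∀ {r} a b (w u : F2 r) →
  character (false ∷ w) (a ∷ u) + (-1^ b) * character (true ∷ w) (a ∷ u)
  ≡ + 2 * toℤ (does (a ≟ b)) * character w u
parity-split a b w u with u · w
parity-split true  true  w u | true  = refl
parity-split true  true  w u | false = refl
parity-split true  false w u | true  = refl
parity-split true  false w u | false = refl
parity-split false true  w u | true  = refl
parity-split false true  w u | false = refl
parity-split false false w u | true  = refl
parity-split false false w u | false = refl

cylinder∈span-character : ∀ {r} (S : Subset r) d → InSpan character (λ u → + (2 ^ ∣ S ∣) * cylinder S d u)
cylinder∈span-character [] [] = InSpan-resp (λ { [] → refl }) (InSpan-gen [])
cylinder∈span-character (outside ∷ S) d =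
  InSpan-resp (λ { (a ∷ u) → *-identityˡ _ })
              (InSpan-pullback (λ _ → + 1) tail outside-gen (cylinder∈span-character S d))
  where
  outside-gen : ∀ w → InSpan character (λ x → + 1 * character w (tail x))
  outside-gen w = InSpan-resp (λ { (true ∷ u) → sym (*-identityˡ _) ; (false ∷ u) → sym (*-identityˡ _) })
                              (InSpan-gen (false ∷ w))
cylinder∈span-character (inside ∷ S) (b ∷ d) =
  InSpan-resp (λ { (a ∷ u) → regroup a u })
              (InSpan-pullback (λ x → + 2 * toℤ (does (head x ≟ b))) tail inside-gen (cylinder∈span-character S d))
  where
  inside-gen : ∀ w → InSpan character (λ x → + 2 * toℤ (does (head x ≟ b)) * character w (tail x))
  inside-gen w = InSpan-resp (λ { (a ∷ u) → parity-split a b w u })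
                             (InSpan-+ (InSpan-gen (false ∷ w)) (InSpan-* (-1^ b) (InSpan-gen (true ∷ w))))

  regroup : ∀ a u → + 2 * toℤ (does (a ≟ b)) * (+ (2 ^ ∣ S ∣) * cylinder S d u)
                    ≡ + (2 ^ ∣ inside ∷ S ∣) * cylinder (inside ∷ S) (b ∷ d) (a ∷ u)
  regroup a u = begin
    + 2 * t * (+ (2 ^ ∣ S ∣) * c)      ≡⟨ reorder (+ 2) t (+ (2 ^ ∣ S ∣)) c ⟩
    + 2 * + (2 ^ ∣ S ∣) * (t * c)      ≡⟨ cong (_* (t * c)) (sym (pos-* 2 (2 ^ ∣ S ∣))) ⟩
    + (2 ^ suc ∣ S ∣) * (t * c)        ≡⟨ cong (+ (2 ^ suc ∣ S ∣) *_) (sym (cylinder-inside a b d u)) ⟩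
    + (2 ^ suc ∣ S ∣) * cylinder (inside ∷ S) (b ∷ d) (a ∷ u) ∎
    where
    open ≡-Reasoning
    t = toℤ (does (a ≟ b))
    c = cylinder S d u
    reorder : ∀ x y z w → x * y * (z * w) ≡ x * z * (y * w)
    reorder = solve-∀

rightGen∈span : ∀ {r} (j : RightIdx r) → InSpan leftGen (rightGen j)
rightGen∈span {r} j@(S , _ , d , d≢0) with cylinder∈span-character S d
... | cs , cylinder≗ = InSpan-resp halve (InSpan-* (- + 1) (cs , λ _ → refl))
  where
  open ≡-Reasoning
  L = lincomb leftGen cs
  0⃗ = replicate r false

  constant-term : lincomb character cs 0⃗ ≡ + 0
  constant-term = begin
    lincomb character cs 0⃗            ≡⟨ sym (cylinder≗ 0⃗) ⟩
    + (2 ^ ∣ S ∣) * cylinder S d 0⃗    ≡⟨ cong (+ (2 ^ ∣ S ∣) *_) (cylinder-zero S d d≢0) ⟩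
    + (2 ^ ∣ S ∣) * + 0               ≡⟨ *-zeroʳ (+ (2 ^ ∣ S ∣)) ⟩
    + 0                               ∎

  halve : ∀ u → - + 1 * L u ≡ rightGen j u
  halve u = *-cancelˡ-≡ (+ 2) _ _ (begin
    + 2 * (- + 1 * L u)                         ≡⟨ negate (L u) ⟩
    + 0 - + 2 * L u                             ≡⟨ cong (_- + 2 * L u) (sym constant-term) ⟩
    lincomb character cs 0⃗ - + 2 * L u          ≡⟨ sym (lincomb-character cs u) ⟩
    lincomb character cs u                      ≡⟨ sym (cylinder≗ u) ⟩
    + (2 ^ ∣ S ∣) * cylinder S d u              ≡⟨ sym (rightGen-double j u) ⟩
    + 2 * rightGen j u                          ∎)
    where
    negate : ∀ x → + 2 * (- + 1 * x) ≡ + 0 - + 2 * x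
    negate = solve-∀

mainTheorem7 : (r : ℕ) → SpanEq (leftGen {r}) (rightGen {r})
mainTheorem7 r = leftGen∈span , rightGen∈span
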